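{- Let $n > 11$ be an integer, $r=n-4$, and let $G$ be an $r$-regular graph on $n$ vertices with $m$ edges. Let $k$ be a positive integer with $k\le r$ and suppose $G$ contains no clique of size $k$. For each integer $i$ with $0\le i\le r-k$ let $$p_{k+i}(G)=\max\{\,m-\|S\| : S\subseteq V(G),\ |S|=k+i\,\}.$$ Let $x = m-\left(kr-\binom{k}{2}\right)$. Then (i) $p_k(G)\le x-1$, and (ii) for every $i\in[r-k]$, $p_{k+i}(G)\le p_{k+i-1}(G)-\bigl(r-(k+i-2)\bigr)$.
   Context: For $S\subseteq V(G)$, $\|S\|$ denotes the number of edges of $G$ having at least one endpoint in $S$. $[N]=\{1,\dots,N\}$. -}

module Defs where

open import Data.Bool using (Bool; true; false; T; _∧_; _∨_; if_then_else_)
open import Data.Nat using (ℕ; zero; suc; _+_; _*_; _⊔_; _<ᵇ_)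
open import Data.Fin using (Fin; toℕ)
open import Data.Fin.Subset using (Subset; Side; inside; outside; ∣_∣; _∈_)
open import Data.Fin.Subset.Properties using (_∈?_)
open import Data.List using (List; []; _∷_; map; concatMap; allFin; filter; foldr; length; sum)
open import Data.Vec using (_∷_; [])
open import Relation.Binary.PropositionalEquality using (_≡_)
open import Relation.Nullary using (¬_; does)
open import Data.Product using (Σ; _×_)

record Graph (n : ℕ) : Set where
  field
    adj   : Fin n → Fin n → Bool
    sym   : ∀ u v → adj u v ≡ adj v u
    irrefl : ∀ v → adj v v ≡ false
open Graph public

countL : {A : Set} → (A → Bool) → List A → ℕ
countL p []       = 0
countL p (x ∷ xs) = (if p x then 1 else 0) + countL p xs

pairs : (n : ℕ) → List (Fin n × Fin n)
pairs n = concatMap (λ u → map (λ v → u Data.Product., v) (allFin n)) (allFin n)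
  where import Data.Product

lt : {n : ℕ} → Fin n × Fin n → Bool
lt (u Data.Product., v) = toℕ u <ᵇ toℕ v
  where import Data.Product

-- the edges of G: each edge uv counted once (as the pair with u < v)
isEdge : {n : ℕ} → Graph n → Fin n × Fin n → Bool
isEdge G (u Data.Product., v) = (toℕ u <ᵇ toℕ v) ∧ adj G u v
  where import Data.Product

numEdges : {n : ℕ} → Graph n → ℕ
numEdges {n} G = countL (isEdge G) (pairs n)

degree : {n : ℕ} → Graph n → Fin n → ℕ
degree {n} G v = countL (adj G v) (allFin n)

Regular : {n : ℕ} → ℕ → Graph n → Set
Regular r G = ∀ v → degree G v ≡ r

memb : {n : ℕ} → Fin n → Subset n → Bool
memb v S = does (v ∈? S)

-- ‖S‖ : number of edges of G having at least one endpoint in S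
edgesTouching : {n : ℕ} → Graph n → Subset n → ℕ
edgesTouching {n} G S =
  countL (λ e → isEdge G e ∧ (memb (Data.Product.proj₁ e) S ∨ memb (Data.Product.proj₂ e) S)) (pairs n)
  where import Data.Product

IsClique : {n : ℕ} → Graph n → Subset n → Set
IsClique G S = ∀ u v → u ∈ S → v ∈ S → ¬ (u ≡ v) → T (adj G u v)

HasClique : {n : ℕ} → Graph n → ℕ → Set
HasClique {n} G k = Σ (Subset n) (λ S → ∣ S ∣ ≡ k × IsClique G S)

allSubsets : (n : ℕ) → List (Subset n)
allSubsets zero    = [] ∷ []
allSubsets (suc n) = concatMap (λ S → (inside ∷ S) ∷ (outside ∷ S) ∷ []) (allSubsets n)

subsetsOfSize : (n j : ℕ) → List (Subset n)
subsetsOfSize n j = filter (λ S → ∣ S ∣ Data.Nat.≟ j) (allSubsets n)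
  where import Data.Nat

-- Note m - ‖S‖ ≥ 0 always (‖S‖ ≤ m), so truncated subtraction is exact, and the
-- fold with base 0 computes the true maximum whenever the family is nonempty (j ≤ n).
p : {n : ℕ} → Graph n → ℕ → ℕ
p {n} G j = foldr (λ S acc → (numEdges G Data.Nat.∸ edgesTouching G S) ⊔ acc) 0 (subsetsOfSize n j)
  where import Data.Nat

module Submission where

open import Defs hiding (sym)
open import Algebra.Properties.CommutativeSemigroup as CommutativeSemigroupProperties using ()
open import Data.Bool using (Bool; true; false; T; not; _∧_; _∨_; if_then_else_)
open import Data.Bool.Properties
  using (∧-assoc; ∧-comm; ∧-identityʳ; ∧-zeroʳ; ∨-comm; ∨-identityʳ; ∨-zeroʳ; T-∧; T-≡)
open import Data.Empty using (⊥-elim)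
open import Data.Fin using (Fin; zero; suc; toℕ)
open import Data.Fin.Properties using (_≟_; any?)
open import Data.Fin.Subset using (Subset; inside; outside; ∣_∣; _∈_; _∉_; _⊆_; ⊥; ⊤; ⁅_⁆; Nonempty)
  renaming (_-_ to _∖_)
open import Data.Fin.Subset.Properties
  using (_∈?_; ∣⊥∣≡0; ∣⊤∣≡n; ⊆-min; in⊆in; out⊆; p─⊥≡p; p─q⊆p; x∈p∧x≢y⇒x∈p-y)
open import Data.Integer using (ℤ; +_; _-_; _⊖_; +≤+) renaming (_≤_ to _≤ℤ_; _+_ to _+ℤ_)
import Data.Integer.Properties as ℤ
open import Data.Integer.Tactic.RingSolver using () renaming (solve-∀ to ℤ-solve-∀)
open import Data.List using (List; []; _∷_; _++_; map; concatMap; tabulate; foldr)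
open import Data.List.Membership.Propositional using () renaming (_∈_ to _∈ₗ_)
open import Data.List.Membership.Propositional.Properties using (∈-filter⁺; ∈-filter⁻; ∈-++⁺ʳ)
open import Data.List.Properties using (map-tabulate)
open import Data.List.Relation.Unary.Any using (here; there)
open import Data.Nat using (ℕ; zero; suc; _+_; _*_; _∸_; _⊔_; _<_; _≤_; _<ᵇ_; z≤n; s≤s)
open import Data.Nat.Combinatorics using (_C_; nCk+nC[k+1]≡[n+1]C[k+1]; nC1≡n)
import Data.Nat.Properties as ℕ
open import Data.Product using (_×_; _,_; proj₁; proj₂; ∃-syntax)
open import Data.Sum using (_⊎_; inj₁; inj₂)
open import Data.Vec using (_∷_; []; here; there)
open import Function using (_∘_; id)
open import Function.Bundles using (Equivalence)
open import Relation.Binary.PropositionalEquality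
  using (_≡_; refl; sym; trans; cong; cong₂; subst; subst₂; module ≡-Reasoning)
open import Relation.Nullary using (¬_; yes; no; does; ¬?)
open import Relation.Nullary.Decidable using (dec-true; dec-false; T?; decidable-stable; _×-dec_)

open CommutativeSemigroupProperties ℕ.+-commutativeSemigroup using (interchange; xy∙z≈xz∙y)

-- Write missing(S) = m − ‖S‖ for the number of edges with no endpoint in S; then p_j
-- is the maximum of missing(S) over the j-sets S.  The key fact is the removal
-- identity: deleting v from S frees exactly the edges from v to vertices outside S ∖ v,
--     missing(S) + deg v = missing(S ∖ v) + #(neighbours of v in S ∖ v).
-- With deg v = r the neighbour count is at most |S| − 1, and at most |S| − 2 if some
-- vertex of S is not adjacent to v.  Iterating the first bound gives
-- missing(S) + |S| r ≤ m + C(|S|, 2).  As G has no k-clique, a j-set realising p_j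
-- (j ≥ k) contains a non-adjacent pair {u, v}; removing u with the sharper bound gives
-- (i) via the iterated bound for S ∖ u, and (ii) via missing(S ∖ u) ≤ p_{j−1}.

𝟙 : Bool → ℕ
𝟙 b = if b then 1 else 0

sumF : ∀ {n} → (Fin n → ℕ) → ℕ
sumF {zero}  F = 0
sumF {suc n} F = F zero + sumF (F ∘ suc)

count : ∀ {n} → (Fin n → Bool) → ℕ
count f = sumF (λ u → 𝟙 (f u))

_==_ : ∀ {n} → Fin n → Fin n → Bool
u == v = does (u ≟ v)

sumF-cong : ∀ {n} {F H : Fin n → ℕ} → (∀ u → F u ≡ H u) → sumF F ≡ sumF H
sumF-cong {zero}  F≗H = refl
sumF-cong {suc n} F≗H = cong₂ _+_ (F≗H zero) (sumF-cong (F≗H ∘ suc))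

sumF-+ : ∀ {n} (F H : Fin n → ℕ) → sumF (λ u → F u + H u) ≡ sumF F + sumF H
sumF-+ {zero}  F H = refl
sumF-+ {suc n} F H =
  trans (cong (_+_ (F zero + H zero)) (sumF-+ (F ∘ suc) (H ∘ suc))) (interchange (F zero) (H zero) _ _)

sumF-zero : ∀ n → sumF {n} (λ _ → 0) ≡ 0
sumF-zero zero    = refl
sumF-zero (suc n) = sumF-zero n

sumF-delta : ∀ {n} (v : Fin n) (F : Fin n → ℕ) → sumF (λ u → if u == v then F u else 0) ≡ F v
sumF-delta {suc n} zero    F = trans (cong (_+_ (F zero)) (sumF-zero n)) (ℕ.+-identityʳ (F zero))
sumF-delta {suc n} (suc v) F = sumF-delta v (F ∘ suc)

sumF-mono : ∀ {n} {F H : Fin n → ℕ} → (∀ u → F u ≤ H u) → sumF F ≤ sumF H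
sumF-mono {zero}  F≤H = z≤n
sumF-mono {suc n} F≤H = ℕ.+-mono-≤ (F≤H zero) (sumF-mono (F≤H ∘ suc))

𝟙-∧ : ∀ b c → 𝟙 (b ∧ c) ≡ (if b then 𝟙 c else 0)
𝟙-∧ false c = refl
𝟙-∧ true  c = refl

𝟙-split : ∀ b c → 𝟙 b ≡ 𝟙 (b ∧ c) + 𝟙 (b ∧ not c)
𝟙-split false c     = refl
𝟙-split true  false = refl
𝟙-split true  true  = refl

𝟙-mono : ∀ {b c} → (T b → T c) → 𝟙 b ≤ 𝟙 c
𝟙-mono {false}         _   = z≤n
𝟙-mono {true}  {true}  _   = ℕ.≤-refl
𝟙-mono {true}  {false} b⇒c = ⊥-elim (b⇒c _)

-- De Morgan's law, regrouped; it splits "misses S" into "misses S ∖ v" and "avoids v".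
not-∨-interchange : ∀ a b x y → not ((a ∨ x) ∨ (b ∨ y)) ≡ not (a ∨ b) ∧ not (x ∨ y)
not-∨-interchange true  b     x y = refl
not-∨-interchange false true  x y = cong not (∨-zeroʳ x)
not-∨-interchange false false x y = refl

count-cong : ∀ {n} {f g : Fin n → Bool} → (∀ u → f u ≡ g u) → count f ≡ count g
count-cong f≗g = sumF-cong (cong 𝟙 ∘ f≗g)

count-split : ∀ {n} (f g : Fin n → Bool) →
              count f ≡ count (λ u → f u ∧ g u) + count (λ u → f u ∧ not (g u))
count-split f g =
  trans (sumF-cong (λ u → 𝟙-split (f u) (g u))) (sumF-+ (λ u → 𝟙 (f u ∧ g u)) (λ u → 𝟙 (f u ∧ not (g u))))

count-mono : ∀ {n} {f g : Fin n → Bool} → (∀ u → T (f u) → T (g u)) → count f ≤ count g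
count-mono f⇒g = sumF-mono (λ u → 𝟙-mono (f⇒g u))

count-guard : ∀ {n} b (f : Fin n → Bool) → count (λ u → b ∧ f u) ≡ (if b then count f else 0)
count-guard {n} false f = sumF-zero n
count-guard     true  f = refl

count-delta : ∀ {n} (v : Fin n) (f : Fin n → Bool) → count (λ u → (u == v) ∧ f u) ≡ 𝟙 (f v)
count-delta v f = trans (sumF-cong (λ u → 𝟙-∧ (u == v) (f u))) (sumF-delta v (𝟙 ∘ f))

countL-cong : {A : Set} {f g : A → Bool} → (∀ x → f x ≡ g x) → ∀ xs → countL f xs ≡ countL g xs
countL-cong f≗g []       = refl
countL-cong f≗g (x ∷ xs) = cong₂ _+_ (cong 𝟙 (f≗g x)) (countL-cong f≗g xs)

countL-split : {A : Set} (f g : A → Bool) (xs : List A) →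
               countL f xs ≡ countL (λ x → f x ∧ g x) xs + countL (λ x → f x ∧ not (g x)) xs
countL-split f g []       = refl
countL-split f g (x ∷ xs) =
  trans (cong₂ _+_ (𝟙-split (f x) (g x)) (countL-split f g xs)) (interchange (𝟙 (f x ∧ g x)) _ _ _)

countL-++ : {A : Set} (f : A → Bool) (xs ys : List A) → countL f (xs ++ ys) ≡ countL f xs + countL f ys
countL-++ f []       ys = refl
countL-++ f (x ∷ xs) ys = trans (cong (_+_ (𝟙 (f x))) (countL-++ f xs ys)) (sym (ℕ.+-assoc (𝟙 (f x)) _ _))

countL-tabulate : ∀ {n} {A : Set} (f : A → Bool) (g : Fin n → A) → countL f (tabulate g) ≡ count (f ∘ g)
countL-tabulate {zero}  f g = refl
countL-tabulate {suc n} f g = cong (_+_ (𝟙 (f (g zero)))) (countL-tabulate f (g ∘ suc))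

countL-concatMap : ∀ {n} {A B : Set} (f : B → Bool) (h : A → List B) (g : Fin n → A) →
                   countL f (concatMap h (tabulate g)) ≡ sumF (λ u → countL f (h (g u)))
countL-concatMap {zero}  f h g = refl
countL-concatMap {suc n} f h g =
  trans (countL-++ f (h (g zero)) _) (cong (_+_ (countL f (h (g zero)))) (countL-concatMap f h (g ∘ suc)))

countL-pairs : ∀ n (P : Fin n × Fin n → Bool) → countL P (pairs n) ≡ sumF (λ u → count (λ w → P (u , w)))
countL-pairs n P = trans (countL-concatMap P row id) (sumF-cong countRow)
  where
  row : Fin n → List (Fin n × Fin n)
  row u = map (u ,_) (tabulate id)
  countRow : ∀ u → countL P (row u) ≡ count (λ w → P (u , w))
  countRow u = trans (cong (countL P) (map-tabulate id (u ,_))) (countL-tabulate P (u ,_))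

pairs-first : ∀ n (v : Fin n) (Q : Fin n × Fin n → Bool) →
              countL (λ e → (proj₁ e == v) ∧ Q e) (pairs n) ≡ count (λ w → Q (v , w))
pairs-first n v Q = begin
    countL (λ e → (proj₁ e == v) ∧ Q e) (pairs n)
  ≡⟨ countL-pairs n _ ⟩
    sumF (λ u → count (λ w → (u == v) ∧ Q (u , w)))
  ≡⟨ sumF-cong (λ u → count-guard (u == v) (λ w → Q (u , w))) ⟩
    sumF (λ u → if u == v then count (λ w → Q (u , w)) else 0)
  ≡⟨ sumF-delta v (λ u → count (λ w → Q (u , w))) ⟩
    count (λ w → Q (v , w)) ∎
  where open ≡-Reasoning

pairs-second : ∀ n (v : Fin n) (Q : Fin n × Fin n → Bool) →
               countL (λ e → (proj₂ e == v) ∧ Q e) (pairs n) ≡ count (λ u → Q (u , v))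
pairs-second n v Q =
  trans (countL-pairs n _) (sumF-cong (λ u → count-delta v (λ w → Q (u , w))))

below : ∀ {n} → Fin n → Fin n → Bool
below u w = toℕ u <ᵇ toℕ w

below-irrefl : ∀ {n} (v : Fin n) → below v v ≡ false
below-irrefl zero    = refl
below-irrefl (suc v) = below-irrefl v

below-trichotomy : ∀ {n} (v w : Fin n) → not (below v w) ≡ below w v ∨ (w == v)
below-trichotomy zero    zero    = refl
below-trichotomy zero    (suc w) = refl
below-trichotomy (suc v) zero    = refl
below-trichotomy (suc v) (suc w) = below-trichotomy v w

ordered : ∀ {n} → (Fin n → Fin n → Bool) → Fin n × Fin n → Bool
ordered R e = below (proj₁ e) (proj₂ e) ∧ R (proj₁ e) (proj₂ e)

incident : ∀ {n} → Fin n → Fin n × Fin n → Bool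
incident v e = (proj₁ e == v) ∨ (proj₂ e == v)

pairs-at-vertex : ∀ {n} (R : Fin n → Fin n → Bool) → (∀ u w → R u w ≡ R w u) →
                  (v : Fin n) → R v v ≡ false →
                  countL (λ e → ordered R e ∧ incident v e) (pairs n) ≡ count (R v)
pairs-at-vertex {n} R R-sym v loopless = begin
    countL (λ e → ordered R e ∧ incident v e) (pairs n)
  ≡⟨ countL-split _ (λ e → proj₁ e == v) (pairs n) ⟩
    countL (λ e → (ordered R e ∧ incident v e) ∧ (proj₁ e == v)) (pairs n)
      + countL (λ e → (ordered R e ∧ incident v e) ∧ not (proj₁ e == v)) (pairs n)
  ≡⟨ cong₂ _+_ (countL-cong starts-at-v (pairs n)) (countL-cong ends-at-v (pairs n)) ⟩
    countL (λ e → (proj₁ e == v) ∧ ordered R e) (pairs n)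
      + countL (λ e → (proj₂ e == v) ∧ ordered R e) (pairs n)
  ≡⟨ cong₂ _+_ (pairs-first n v (ordered R)) (pairs-second n v (ordered R)) ⟩
    count (λ w → below v w ∧ R v w) + count (λ w → below w v ∧ R w v)
  ≡⟨ sym (cong₂ _+_ (count-cong (λ w → ∧-comm (R v w) (below v w))) (count-cong behind)) ⟩
    count (λ w → R v w ∧ below v w) + count (λ w → R v w ∧ not (below v w))
  ≡⟨ sym (count-split (R v) (below v)) ⟩
    count (R v) ∎
  where
  open ≡-Reasoning
  starts-at-v : ∀ e → (ordered R e ∧ incident v e) ∧ (proj₁ e == v) ≡ (proj₁ e == v) ∧ ordered R e
  starts-at-v (u , w) with u ≟ v
  ... | yes _ = trans (∧-identityʳ _) (∧-identityʳ _)
  ... | no  _ = ∧-zeroʳ _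
  -- A pair through v not starting at v ends at v; the pair (v , v) is not ordered.
  ends-at-v : ∀ e → (ordered R e ∧ incident v e) ∧ not (proj₁ e == v) ≡ (proj₂ e == v) ∧ ordered R e
  ends-at-v (u , w) with u ≟ v
  ... | no _ = trans (∧-identityʳ _) (∧-comm (ordered R (u , w)) (w == v))
  ... | yes refl with w ≟ u
  ...   | no  _    = ∧-zeroʳ _
  ...   | yes refl rewrite below-irrefl u = refl
  behind : ∀ w → R v w ∧ not (below v w) ≡ below w v ∧ R w v
  behind w rewrite below-trichotomy v w with w ≟ v
  ... | yes refl rewrite loopless | below-irrefl v = refl
  ... | no  _    rewrite ∨-identityʳ (below w v) =
    trans (∧-comm (R v w) (below w v)) (cong (below w v ∧_) (R-sym v w))

memb-true : ∀ {n} {w : Fin n} {S : Subset n} → w ∈ S → memb w S ≡ true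
memb-true {w = w} {S} = dec-true (w ∈? S)

memb-false : ∀ {n} {w : Fin n} {S : Subset n} → w ∉ S → memb w S ≡ false
memb-false {w = w} {S} = dec-false (w ∈? S)

memb⇒∈ : ∀ {n} {w : Fin n} {S : Subset n} → T (memb w S) → w ∈ S
memb⇒∈ {w = w} {S} h with w ∈? S
... | yes w∈S = w∈S
... | no  _   = ⊥-elim h

memb-≡ : ∀ {n} {w : Fin n} {S U : Subset n} → (w ∈ S → w ∈ U) → (w ∈ U → w ∈ S) → memb w S ≡ memb w U
memb-≡ {w = w} {S} S⇒U U⇒S with w ∈? S
... | yes w∈S = sym (memb-true (S⇒U w∈S))
... | no  w∉S = sym (memb-false (w∉S ∘ U⇒S))

x∉p-x : ∀ {n} (v : Fin n) (S : Subset n) → v ∉ S ∖ v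
x∉p-x zero    (s ∷ S) ()
x∉p-x (suc v) (s ∷ S) (there v∈S∖v) = x∉p-x v S v∈S∖v

memb-remove : ∀ {n} {v : Fin n} {S : Subset n} → v ∈ S → ∀ w → memb w S ≡ memb w (S ∖ v) ∨ (w == v)
memb-remove {v = v} {S} v∈S w with w ≟ v
... | yes refl = trans (memb-true v∈S) (sym (∨-zeroʳ _))
... | no  w≢v  =
  trans (memb-≡ (λ w∈S → x∈p∧x≢y⇒x∈p-y w∈S w≢v) (p─q⊆p S ⁅ v ⁆)) (sym (∨-identityʳ _))

size-remove : ∀ {n} {v : Fin n} {S : Subset n} → v ∈ S → suc ∣ S ∖ v ∣ ≡ ∣ S ∣
size-remove {S = inside  ∷ S} here           = cong (suc ∘ ∣_∣) (p─⊥≡p S)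
size-remove {S = inside  ∷ S} (there v∈S)    = cong suc (size-remove v∈S)
size-remove {S = outside ∷ S} (there v∈S)    = size-remove v∈S

size-count : ∀ {n} (S : Subset n) → ∣ S ∣ ≡ count (λ w → memb w S)
size-count []            = refl
size-count (inside  ∷ S) = cong suc (size-count S)
size-count (outside ∷ S) = size-count S

nonempty : ∀ {n t} {S : Subset n} → ∣ S ∣ ≡ suc t → Nonempty S
nonempty {S = inside  ∷ S} _ = zero , here
nonempty {S = outside ∷ S} ∣S∣≡1+t with nonempty ∣S∣≡1+t
... | v , v∈S = suc v , there v∈S

subset-of-size : ∀ {n} (S : Subset n) k → k ≤ ∣ S ∣ → ∃[ U ] (U ⊆ S × ∣ U ∣ ≡ k)
subset-of-size {n} S zero _ = ⊥ , ⊆-min S , ∣⊥∣≡0 n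
subset-of-size (inside ∷ S) (suc k) (s≤s k≤∣S∣) with subset-of-size S k k≤∣S∣
... | U , U⊆S , ∣U∣≡k = inside ∷ U , in⊆in U⊆S , cong suc ∣U∣≡k
subset-of-size (outside ∷ S) (suc k) k≤∣S∣ with subset-of-size S (suc k) k≤∣S∣
... | U , U⊆S , ∣U∣≡k = outside ∷ U , out⊆ U⊆S , ∣U∣≡k

∈-allSubsets : ∀ {n} (S : Subset n) → S ∈ₗ allSubsets n
∈-allSubsets []          = here refl
∈-allSubsets {suc n} (s ∷ S) = extend s (allSubsets n) (∈-allSubsets S)
  where
  extend : ∀ s Ss → S ∈ₗ Ss → (s ∷ S) ∈ₗ concatMap (λ U → (inside ∷ U) ∷ (outside ∷ U) ∷ []) Ss
  extend inside  (U ∷ Ss) (here refl)  = here refl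
  extend outside (U ∷ Ss) (here refl)  = there (here refl)
  extend s       (U ∷ Ss) (there S∈Ss) = ∈-++⁺ʳ _ (extend s Ss S∈Ss)

∈-subsetsOfSize : ∀ {n j} (S : Subset n) → ∣ S ∣ ≡ j → S ∈ₗ subsetsOfSize n j
∈-subsetsOfSize {j = j} S = ∈-filter⁺ (λ U → ∣ U ∣ ℕ.≟ j) (∈-allSubsets S)

subsetsOfSize-size : ∀ {n j} {S : Subset n} → S ∈ₗ subsetsOfSize n j → ∣ S ∣ ≡ j
subsetsOfSize-size {n} {j} S∈ = proj₂ (∈-filter⁻ (λ U → ∣ U ∣ ℕ.≟ j) {xs = allSubsets n} S∈)

module _ {A : Set} (f : A → ℕ) where

  foldMax : List A → ℕ
  foldMax = foldr (λ x acc → f x ⊔ acc) 0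

  ≤-foldMax : ∀ {x} xs → x ∈ₗ xs → f x ≤ foldMax xs
  ≤-foldMax (y ∷ xs) (here refl) = ℕ.m≤m⊔n (f y) _
  ≤-foldMax (y ∷ xs) (there x∈)  = ℕ.≤-trans (≤-foldMax xs x∈) (ℕ.m≤n⊔m (f y) _)

  foldMax-attained : ∀ {x} xs → x ∈ₗ xs → ∃[ y ] (y ∈ₗ xs × foldMax xs ≤ f y)
  foldMax-attained (y ∷ [])     _ = y , here refl , ℕ.≤-reflexive (ℕ.⊔-identityʳ (f y))
  foldMax-attained (y ∷ z ∷ zs) _ with foldMax-attained (z ∷ zs) (here refl)
  ... | y′ , y′∈ , rest≤y′ with ℕ.≤-total (f y) (f y′)
  ...   | inj₁ y≤y′ = y′ , there y′∈ , ℕ.⊔-lub y≤y′ rest≤y′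
  ...   | inj₂ y′≤y = y , here refl , ℕ.⊔-lub ℕ.≤-refl (ℕ.≤-trans rest≤y′ y′≤y)

module _ {n : ℕ} (G : Graph n) where

  touches : Subset n → Fin n × Fin n → Bool
  touches S e = memb (proj₁ e) S ∨ memb (proj₂ e) S

  missing : Subset n → ℕ
  missing S = countL (λ e → isEdge G e ∧ not (touches S e)) (pairs n)

  edges-split : ∀ S → numEdges G ≡ edgesTouching G S + missing S
  edges-split S = countL-split (isEdge G) (touches S) (pairs n)

  missing≤numEdges : ∀ S → missing S ≤ numEdges G
  missing≤numEdges S = subst (missing S ≤_) (sym (edges-split S)) (ℕ.m≤n+m _ _)

  p-value : ∀ S → numEdges G ∸ edgesTouching G S ≡ missing S
  p-value S = trans (cong (_∸ edgesTouching G S) (edges-split S)) (ℕ.m+n∸m≡n (edgesTouching G S) (missing S))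

  p-upper : ∀ {j} (S : Subset n) → ∣ S ∣ ≡ j → missing S ≤ p G j
  p-upper {j} S ∣S∣≡j =
    subst (_≤ p G j) (p-value S) (≤-foldMax (λ U → numEdges G ∸ edgesTouching G U) _ (∈-subsetsOfSize S ∣S∣≡j))

  p-attained : ∀ {j} → j ≤ n → ∃[ S ] (∣ S ∣ ≡ j × p G j ≤ missing S)
  p-attained {j} j≤n with subset-of-size ⊤ j (subst (j ≤_) (sym (∣⊤∣≡n n)) j≤n)
  ... | S₀ , _ , ∣S₀∣≡j
    with foldMax-attained (λ U → numEdges G ∸ edgesTouching G U) _ (∈-subsetsOfSize S₀ ∣S₀∣≡j)
  ... | S , S∈ , pj≤ = S , subsetsOfSize-size S∈ , subst (p G j ≤_) (p-value S) pj≤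

  nbrs : Fin n → Subset n → ℕ
  nbrs v U = count (λ w → adj G v w ∧ memb w U)

  nbrs≤size : ∀ v U → nbrs v U ≤ ∣ U ∣
  nbrs≤size v U =
    ℕ.≤-trans (count-mono (λ w → proj₂ ∘ Equivalence.to (T-∧ {adj G v w} {memb w U})))
              (ℕ.≤-reflexive (sym (size-count U)))

  nbrs-gap : ∀ {u v U} → u ∈ U → ¬ T (adj G v u) → nbrs v U ≤ ∣ U ∖ u ∣
  nbrs-gap {u} {v} {U} u∈U ¬adj =
    ℕ.≤-trans (count-mono inside-U∖u) (ℕ.≤-reflexive (sym (size-count (U ∖ u))))
    where
    inside-U∖u : ∀ w → T (adj G v w ∧ memb w U) → T (memb w (U ∖ u))
    inside-U∖u w h with Equivalence.to (T-∧ {adj G v w} {memb w U}) h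
    ... | adj-vw , w∈U =
      Equivalence.from T-≡ (memb-true {w = w} {U ∖ u} (x∈p∧x≢y⇒x∈p-y (memb⇒∈ {w = w} {U} w∈U) λ { refl → ¬adj adj-vw }))

  missing-remove : ∀ {v S} → v ∈ S →
                   missing (S ∖ v) ≡ count (λ w → adj G v w ∧ not (memb w (S ∖ v))) + missing S
  missing-remove {v} {S} v∈S = begin
      missing U
    ≡⟨ countL-split _ (incident v) (pairs n) ⟩
      countL (λ e → (isEdge G e ∧ not (touches U e)) ∧ incident v e) (pairs n)
        + countL (λ e → (isEdge G e ∧ not (touches U e)) ∧ not (incident v e)) (pairs n)
    ≡⟨ cong₂ _+_ (countL-cong (λ e → cong (_∧ incident v e) (∧-assoc (below (proj₁ e) (proj₂ e)) _ _)) (pairs n))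
                 (countL-cong misses-S (pairs n)) ⟩
      countL (λ e → ordered R e ∧ incident v e) (pairs n) + missing S
    ≡⟨ cong (_+ missing S) (pairs-at-vertex R R-sym v R-loopless) ⟩
      count (R v) + missing S
    ≡⟨ cong (_+ missing S) (count-cong (λ w → cong (λ b → adj G v w ∧ not (b ∨ memb w U))
                                                       (memb-false (x∉p-x v S)))) ⟩
      count (λ w → adj G v w ∧ not (memb w U)) + missing S ∎
    where
    open ≡-Reasoning
    U : Subset n
    U = S ∖ v
    R : Fin n → Fin n → Bool
    R u w = adj G u w ∧ not (touches U (u , w))
    R-sym : ∀ u w → R u w ≡ R w u
    R-sym u w = cong₂ _∧_ (Graph.sym G u w) (cong not (∨-comm (memb u U) _))
    R-loopless : R v v ≡ false
    R-loopless = cong (_∧ not (touches U (v , v))) (irrefl G v)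
    misses-S : ∀ e → (isEdge G e ∧ not (touches U e)) ∧ not (incident v e) ≡ isEdge G e ∧ not (touches S e)
    misses-S (a , b) = begin
        (isEdge G (a , b) ∧ not (touches U (a , b))) ∧ not (incident v (a , b))
      ≡⟨ ∧-assoc (isEdge G (a , b)) _ _ ⟩
        isEdge G (a , b) ∧ (not (touches U (a , b)) ∧ not (incident v (a , b)))
      ≡⟨ cong (isEdge G (a , b) ∧_) (sym (not-∨-interchange (memb a U) (memb b U) (a == v) (b == v))) ⟩
        isEdge G (a , b) ∧ not ((memb a U ∨ (a == v)) ∨ (memb b U ∨ (b == v)))
      ≡⟨ cong (λ t → isEdge G (a , b) ∧ not t) (sym (cong₂ _∨_ (memb-remove v∈S a) (memb-remove v∈S b))) ⟩
        isEdge G (a , b) ∧ not (touches S (a , b)) ∎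

  removal : ∀ {v S} → v ∈ S → missing S + degree G v ≡ missing (S ∖ v) + nbrs v (S ∖ v)
  removal {v} {S} v∈S = begin
      missing S + degree G v
    ≡⟨ cong (_+_ (missing S)) (trans (countL-tabulate (adj G v) id) (count-split (adj G v) (λ w → memb w U))) ⟩
      missing S + (nbrs v U + freed)
    ≡⟨ trans (ℕ.+-comm (missing S) _) (ℕ.+-assoc (nbrs v U) freed (missing S)) ⟩
      nbrs v U + (freed + missing S)
    ≡⟨ trans (ℕ.+-comm (nbrs v U) _) (cong (_+ nbrs v U) (sym (missing-remove v∈S))) ⟩
      missing U + nbrs v U ∎
    where
    open ≡-Reasoning
    U : Subset n
    U = S ∖ v
    freed : ℕ
    freed = count (λ w → adj G v w ∧ not (memb w U))

  Gap : Subset n → Set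
  Gap S = ∃[ u ] ∃[ v ] (u ∈ S × v ∈ S × ¬ (u ≡ v) × ¬ T (adj G u v))

  clique-or-gap : (S : Subset n) → IsClique G S ⊎ Gap S
  clique-or-gap S
    with any? (λ u → any? (λ v → u ∈? S ×-dec v ∈? S ×-dec ¬? (u ≟ v) ×-dec ¬? (T? (adj G u v))))
  ... | yes gap   = inj₂ gap
  ... | no  noGap = inj₁ λ u v u∈S v∈S u≢v →
    decidable-stable (T? (adj G u v)) (λ ¬adj → noGap (u , v , u∈S , v∈S , u≢v , ¬adj))

  gap-of-large-set : ∀ {k} → ¬ HasClique G k → ∀ {S} → k ≤ ∣ S ∣ → Gap S
  gap-of-large-set {k} noClique {S} k≤∣S∣ with clique-or-gap S
  ... | inj₂ gap    = gap
  ... | inj₁ clique with subset-of-size S k k≤∣S∣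
  ...   | U , U⊆S , ∣U∣≡k =
    ⊥-elim (noClique (U , ∣U∣≡k , λ u w u∈U w∈U → clique u w (U⊆S u∈U) (U⊆S w∈U)))

chain : ∀ {a r b t s c} → a + r ≤ b + t → b + s ≤ c → a + (r + s) ≤ c + t
chain {a} {r} {b} {t} {s} {c} h₁ h₂ = begin
    a + (r + s)  ≡⟨ sym (ℕ.+-assoc a r s) ⟩
    a + r + s    ≤⟨ ℕ.+-monoˡ-≤ s h₁ ⟩
    b + t + s    ≡⟨ xy∙z≈xz∙y b t s ⟩
    b + s + t    ≤⟨ ℕ.+-monoˡ-≤ t h₂ ⟩
    c + t        ∎
  where open ℕ.≤-Reasoning

pascal : ∀ c t → c + t C 2 + t ≡ c + suc t C 2
pascal c t = begin
    c + t C 2 + t    ≡⟨ xy∙z≈xz∙y c (t C 2) t ⟩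
    c + t + t C 2    ≡⟨ ℕ.+-assoc c t _ ⟩
    c + (t + t C 2)  ≡⟨ cong (λ x → c + (x + t C 2)) (sym (nC1≡n t)) ⟩
    c + (t C 1 + t C 2) ≡⟨ cong (_+_ c) (nCk+nC[k+1]≡[n+1]C[k+1] t 1) ⟩
    c + suc t C 2    ∎
  where open ≡-Reasoning

pred-bound : ∀ {a b c} → suc a ≤ b + c → a ≤ b + (c ∸ 1)
pred-bound {a} {b} {zero}  h = ℕ.≤-trans (ℕ.n≤1+n a) h
pred-bound {a} {b} {suc c} h = ℕ.≤-pred (subst (suc a ≤_) (ℕ.+-suc b c) h)

module RegularBounds {n r : ℕ} (G : Graph n) (regular : Regular r G) where

  regular-removal : ∀ {v S} → v ∈ S → missing G S + r ≡ missing G (S ∖ v) + nbrs G v (S ∖ v)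
  regular-removal {v} {S} v∈S = trans (cong (_+_ (missing G S)) (sym (regular v))) (removal G v∈S)

  -- Removing any vertex: v has at most |S ∖ v| neighbours in S ∖ v.
  removal-step : ∀ {v S} → v ∈ S → missing G S + r ≤ missing G (S ∖ v) + ∣ S ∖ v ∣
  removal-step {v} {S} v∈S = begin
    missing G S + r                        ≡⟨ regular-removal v∈S ⟩
    missing G (S ∖ v) + nbrs G v (S ∖ v)  ≤⟨ ℕ.+-monoʳ-≤ (missing G (S ∖ v)) (nbrs≤size G v (S ∖ v)) ⟩
    missing G (S ∖ v) + ∣ S ∖ v ∣         ∎
    where open ℕ.≤-Reasoning

  -- Removing one vertex u of a gap {u, v} gains one more, as v is not a neighbour of u.
  gap-step : ∀ {S} → Gap G S → ∃[ U ] (suc ∣ U ∣ ≡ ∣ S ∣ × suc (missing G S + r) ≤ missing G U + ∣ U ∣)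
  gap-step {S} (u , v , u∈S , v∈S , u≢v , ¬adj) = U , size-remove u∈S , bound
    where
    open ℕ.≤-Reasoning
    U : Subset n
    U = S ∖ u
    v∈U : v ∈ U
    v∈U = x∈p∧x≢y⇒x∈p-y v∈S (u≢v ∘ sym)
    bound : suc (missing G S + r) ≤ missing G U + ∣ U ∣
    bound = begin
      suc (missing G S + r)           ≡⟨ cong suc (regular-removal u∈S) ⟩
      suc (missing G U + nbrs G u U)  ≤⟨ s≤s (ℕ.+-monoʳ-≤ _ (nbrs-gap G v∈U ¬adj)) ⟩
      suc (missing G U + ∣ U ∖ v ∣)   ≡⟨ sym (ℕ.+-suc _ _) ⟩
      missing G U + suc ∣ U ∖ v ∣     ≡⟨ cong (_+_ (missing G U)) (size-remove v∈U) ⟩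
      missing G U + ∣ U ∣             ∎

  missing-bound : ∀ t {S} → ∣ S ∣ ≡ t → missing G S + t * r ≤ numEdges G + t C 2
  missing-bound zero {S} _ =
    subst₂ _≤_ (sym (ℕ.+-identityʳ _)) (sym (ℕ.+-identityʳ _)) (missing≤numEdges G S)
  missing-bound (suc t) {S} ∣S∣≡1+t with nonempty ∣S∣≡1+t
  ... | v , v∈S = begin
    missing G S + (r + t * r)      ≤⟨ chain {missing G S} {r} {missing G (S ∖ v)} {t} {t * r} step
                                            (missing-bound t ∣S∖v∣≡t) ⟩
    numEdges G + t C 2 + t         ≡⟨ pascal (numEdges G) t ⟩
    numEdges G + suc t C 2         ∎
    where
    open ℕ.≤-Reasoning
    ∣S∖v∣≡t : ∣ S ∖ v ∣ ≡ t
    ∣S∖v∣≡t = ℕ.suc-injective (trans (size-remove v∈S) ∣S∣≡1+t)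
    step : missing G S + r ≤ missing G (S ∖ v) + t
    step = subst (λ x → missing G S + r ≤ missing G (S ∖ v) + x) ∣S∖v∣≡t (removal-step v∈S)

  -- A (t+1)-set realising p_{t+1} (k ≤ t + 1 ≤ n) has a gap; remove one of its vertices.
  maximiser-step : ∀ {k} t → ¬ HasClique G k → k ≤ suc t → suc t ≤ n →
                   ∃[ U ] (∣ U ∣ ≡ t × suc (p G (suc t) + r) ≤ missing G U + t)
  maximiser-step {k} t noClique k≤1+t 1+t≤n =
    let S , ∣S∣≡1+t , p≤missing-S = p-attained G 1+t≤n
        gap                       = gap-of-large-set G noClique (subst (k ≤_) (sym ∣S∣≡1+t) k≤1+t)
        U , ∣U∣+1≡∣S∣ , step      = gap-step {S} gap
        ∣U∣≡t                     = ℕ.suc-injective (trans ∣U∣+1≡∣S∣ ∣S∣≡1+t)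
    in  U , ∣U∣≡t , ℕ.≤-trans (s≤s (ℕ.+-monoˡ-≤ r p≤missing-S))
                              (subst (λ x → suc (missing G S + r) ≤ missing G U + x) ∣U∣≡t step)

  -- Part (i) in ℕ, for k = t + 1: p_k + kr + 1 ≤ m + C(k, 2).
  p-first : ∀ t → ¬ HasClique G (suc t) → suc t ≤ n →
            p G (suc t) + (suc t * r + 1) ≤ numEdges G + suc t C 2
  p-first t noClique 1+t≤n =
    let U , ∣U∣≡t , step = maximiser-step t noClique ℕ.≤-refl 1+t≤n
    in  begin
      p G k + (k * r + 1)          ≡⟨ cong (_+_ (p G k)) (ℕ.+-comm (k * r) 1) ⟩
      p G k + suc (k * r)          ≡⟨ ℕ.+-suc (p G k) (k * r) ⟩
      suc (p G k) + (r + t * r)    ≤⟨ chain {suc (p G k)} {r} {missing G U} {t} {t * r}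
                                             step (missing-bound t ∣U∣≡t) ⟩
      numEdges G + t C 2 + t       ≡⟨ pascal (numEdges G) t ⟩
      numEdges G + k C 2           ∎
    where
    open ℕ.≤-Reasoning
    k : ℕ
    k = suc t

  -- Part (ii) in ℕ, for j = t + 1: p_j + r ≤ p_{j−1} + (j − 2).
  p-decrease : ∀ {k} t → ¬ HasClique G k → k ≤ suc t → suc t ≤ n → p G (suc t) + r ≤ p G t + (t ∸ 1)
  p-decrease t noClique k≤1+t 1+t≤n =
    let U , ∣U∣≡t , step = maximiser-step t noClique k≤1+t 1+t≤n
    in  pred-bound {p G (suc t) + r} {p G t} {t}
                   (ℕ.≤-trans step (ℕ.+-monoˡ-≤ t (p-upper G U ∣U∣≡t)))

ℕ⇒ℤ : ∀ {a} b c d → a + b ≤ c + d → + a ≤ℤ + c - (+ b - + d)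
ℕ⇒ℤ {a} b c d h = begin
    + a                ≤⟨ +≤+ (ℕ.m+n≤o⇒m≤o∸n a h) ⟩
    + (c + d ∸ b)      ≡⟨ sym (ℤ.⊖-≥ (ℕ.m+n≤o⇒n≤o a h)) ⟩
    (c + d) ⊖ b        ≡⟨ sym (ℤ.m-n≡m⊖n (c + d) b) ⟩
    + (c + d) - + b    ≡⟨ shuffle (+ b) (+ c) (+ d) ⟩
    + c - (+ b - + d)  ∎
  where
  open ℤ.≤-Reasoning
  shuffle : ∀ (x y z : ℤ) → (y +ℤ z) - x ≡ y - (x - z)
  shuffle = ℤ-solve-∀

ℕ⇒ℤ-minus-one : ∀ {a} b c d → a + (b + 1) ≤ c + d → + a ≤ℤ (+ c - (+ b - + d)) - + 1
ℕ⇒ℤ-minus-one {a} b c d h = subst (+ a ≤ℤ_) (shuffle (+ b) (+ c) (+ d)) (ℕ⇒ℤ (b + 1) c d h)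
  where
  shuffle : ∀ (x y z : ℤ) → y - ((x +ℤ + 1) - z) ≡ (y - (x - z)) - + 1
  shuffle = ℤ-solve-∀

-- The theorem: (i) is p-first and (ii) is p-decrease, with r = n − 4, read in ℤ.
-- The case k = 0 is excluded by 1 ≤ k.
lemma2 : (n : ℕ) → 11 < n → (G : Graph n) → Regular (n ∸ 4) G →
         (k : ℕ) → 1 ≤ k → k ≤ n ∸ 4 → ¬ HasClique G k →
         ((+ p G k) ≤ℤ ((+ numEdges G - (+ (k Data.Nat.* (n ∸ 4)) - + (k C 2))) - + 1))
         × ((i : ℕ) → 1 ≤ i → i ≤ (n ∸ 4) ∸ k →
            (+ p G (k Data.Nat.+ i)) ≤ℤ (+ p G (k Data.Nat.+ i ∸ 1) - (+ (n ∸ 4) - + (k Data.Nat.+ i ∸ 2))))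
lemma2 n _ G regular zero    () _ _
lemma2 n _ G regular (suc t) _  k≤r noClique = part-i , part-ii
  where
  open RegularBounds G regular
  r k : ℕ
  r = n ∸ 4
  k = suc t
  r≤n : r ≤ n
  r≤n = ℕ.m∸n≤m n 4
  part-i : + p G k ≤ℤ (+ numEdges G - (+ (k * r) - + (k C 2))) - + 1
  part-i = ℕ⇒ℤ-minus-one (k * r) (numEdges G) (k C 2) (p-first t noClique (ℕ.≤-trans k≤r r≤n))
  part-ii : (i : ℕ) → 1 ≤ i → i ≤ r ∸ k → + p G (k + i) ≤ℤ + p G (k + i ∸ 1) - (+ r - + (k + i ∸ 2))
  part-ii i _ i≤r∸k =
    ℕ⇒ℤ r (p G (k + i ∸ 1)) (k + i ∸ 2)
        (p-decrease (t + i) noClique (s≤s (ℕ.m≤m+n t i)) (ℕ.≤-trans k+i≤r r≤n))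
    where
    k+i≤r : k + i ≤ r
    k+i≤r = ℕ.≤-trans (ℕ.+-monoʳ-≤ k i≤r∸k) (ℕ.≤-reflexive (ℕ.m+[n∸m]≡n k≤r))
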